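{- Let $S=\{R_0,\ldots,R_d\}$ be a quasi-thin association scheme on a nonempty finite set $X$, $\mathbb{F}$ a field, and $x\in X$. Let $\mathcal{T}_0$ be the $\mathbb{F}$-linear span of all matrices $E_i^*A_jE_\ell^*$ with $i,j,\ell\in\{0,\ldots,d\}$. Then $\mathcal{T}_0$ is a unital $\mathbb{F}$-subalgebra of $M_X(\mathbb{F})$ if and only if there do not exist $u,v,w,y,z\in\{0,\ldots,d\}$ with $k_u=k_v=k_w=k_y=k_z=2$ and $p_{uv}^w=p_{wy}^z=|R_{u'}R_z|=1$.
   Context: An association scheme on $X$ is a partition $S=\{R_0,\ldots,R_d\}$ of $X\times X$ into nonempty relations with $R_0$ the diagonal, closed under transposes ($R_{c'}$ the transpose of $R_c$), with $p_{ij}^k=|\{\ell:(m,\ell)\in R_i,(\ell,n)\in R_j\}|$ independent of $(m,n)\in R_k$. Valency $k_a=|xR_a|$, $xR_a=\{z:(x,z)\in R_a\}$; $R_aR_b=\{R_c:p_{ab}^c>0\}$; quasi-thin: all $k_a\le2$. $A_j\in M_X(\mathbb{F})$ is the $(0,1)$ adjacency matrix of $R_j$, $E_i^*$ the diagonal $(0,1)$-matrix with $(m,m)$-entry $1$ iff $m\in xR_i$. -}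

module Defs where

open import Level using (Level; _⊔_)
open import Algebra.Bundles using (CommutativeRing)
open import Data.Nat using (ℕ; zero; suc; _≤_; _<_; _≤?_)
open import Data.Fin using (Fin; zero; suc; _≟_)
open import Data.Bool using (Bool; true; false; if_then_else_; _∧_)
open import Data.Product using (Σ; ∃; ∃-syntax; _×_; _,_)
open import Relation.Nullary using (¬_; does)
open import Relation.Binary.PropositionalEquality using (_≡_)
open import Function.Bundles using (_⇔_)

record Field (c ℓ : Level) : Set (Level.suc (c ⊔ ℓ)) where
  field
    commutativeRing : CommutativeRing c ℓ
  open CommutativeRing commutativeRing public
  field
    1≉0     : ¬ (1# ≈ 0#)
    inverse : ∀ (a : Carrier) → ¬ (a ≈ 0#) → ∃[ b ] (a * b ≈ 1#)

count : ∀ {n} → (Fin n → Bool) → ℕ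
count {zero}  P = 0
count {suc n} P = (if P zero then 1 else 0) + count (λ i → P (suc i))
  where open Data.Nat using (_+_)

-- Association schemes on X = Fin n with relations R_0,…,R_d indexed by
-- Fin (suc d).  The scheme is given by the colouring
-- rel m n = the unique i with (m,n) ∈ R_i (this encodes "partition").

record AssociationScheme (n d : ℕ) : Set where
  field
    rel      : Fin n → Fin n → Fin (suc d)
    nonempty : ∀ (i : Fin (suc d)) → ∃[ m ] ∃[ m' ] (rel m m' ≡ i)
    diagonal : ∀ m m' → (rel m m' ≡ zero) ⇔ (m ≡ m')
    _′       : Fin (suc d) → Fin (suc d)
    transpose : ∀ m m' → rel m' m ≡ (rel m m') ′
    p        : Fin (suc d) → Fin (suc d) → Fin (suc d) → ℕ
    p-spec   : ∀ i j m m' →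
      count (λ l → does (rel m l ≟ i) ∧ does (rel l m' ≟ j)) ≡ p i j (rel m m')

module _ {n d : ℕ} (S : AssociationScheme n d) where
  open AssociationScheme S

  valency : Fin n → Fin (suc d) → ℕ
  valency x a = count (λ z → does (rel x z ≟ a))

  QuasiThin : Fin n → Set
  QuasiThin x = ∀ a → valency x a ≤ 2

  prodSize : Fin (suc d) → Fin (suc d) → ℕ
  prodSize a b = count (λ c → does (1 ≤? p a b c))

module Matrices {c ℓ : Level} (F : Field c ℓ) where
  open Field F using (Carrier; _≈_; _+_; _*_; 0#; 1#)

  Mat : ℕ → Set c
  Mat n = Fin n → Fin n → Carrier

  ∑[_] : ∀ {m} → (Fin m → Carrier) → Carrier
  ∑[_] {zero}  f = 0#
  ∑[_] {suc m} f = f zero + ∑[ (λ i → f (suc i)) ]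

  _≈M_ : ∀ {n} → Mat n → Mat n → Set ℓ
  M ≈M N = ∀ a b → M a b ≈ N a b

  _·_ : ∀ {n} → Mat n → Mat n → Mat n
  (M · N) a b = ∑[ (λ k → M a k * N k b) ]

  _+M_ : ∀ {n} → Mat n → Mat n → Mat n
  (M +M N) a b = M a b + N a b

  _•_ : ∀ {n} → Carrier → Mat n → Mat n
  (s • M) a b = s * M a b

  0M : ∀ {n} → Mat n
  0M a b = 0#

  I : ∀ {n} → Mat n
  I a b = if does (a ≟ b) then 1# else 0#

  module _ {n d : ℕ} (S : AssociationScheme n d) (x : Fin n) where
    open AssociationScheme S

    A : Fin (suc d) → Mat n
    A j a b = if does (rel a b ≟ j) then 1# else 0#

    E* : Fin (suc d) → Mat n
    E* i a b = if does (a ≟ b) ∧ does (rel x a ≟ i) then 1# else 0#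

    InT0 : Mat n → Set (c ⊔ ℓ)
    InT0 M = Σ (Fin (suc d) → Fin (suc d) → Fin (suc d) → Carrier) λ coef → (M ≈M (λ a b →
      ∑[ (λ i → ∑[ (λ j → ∑[ (λ l →
        coef i j l * ((E* i · A j) · E* l) a b) ]) ]) ]))

    UnitalSubalgebra : Set (c ⊔ ℓ)
    UnitalSubalgebra =
        InT0 0M
      × (∀ M N → InT0 M → InT0 N → InT0 (M +M N))
      × (∀ s M → InT0 M → InT0 (s • M))
      × (∀ M N → InT0 M → InT0 N → InT0 (M · N))
      × InT0 I

-- E*_i A_j E*_l is the indicator matrix of the cell {(a,b) : x R_i a, a R_j b, x R_l b}, so T₀ is
-- exactly the space of matrices constant on cells. This space always contains 0 and I and is closed
-- under sums and scalars; it is closed under products when, for all l j r, the number of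
-- c ∈ xR_l with a R_j c R_r b depends only on the cell of (a,b). If that number differs on two
-- pairs of one cell, inclusion–exclusion inside xR_l (of size ≤ 2) forces it to vanish on one
-- pair while each of a and b has a unique neighbour in xR_l; quasi-thinness then determines the
-- relevant valencies and intersection numbers and produces the forbidden configuration. Conversely
-- the configuration yields two pairs (a₁,b), (a₂,b) of one cell on which
-- E*_u A_v E*_w · E*_w A_y E*_z takes the values 1 and 0.

module Submission where

open import Defs
open import Level using (Level)
open import Data.Bool using (true; false; if_then_else_)
open import Data.Nat using (ℕ; zero; suc; _≤_; _<_; z≤n; s≤s; s≤s⁻¹; _≤?_; NonZero)
open import Data.Nat.Properties
  using (≤-refl; ≤-antisym; ≤-trans; ≤-reflexive; ≤-pred; <-≤-trans; <-cmp; n≤0⇒n≡0; m≤n⇒m≤1+n)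
open import Data.Fin using (Fin; zero; suc; punchIn; punchOut; _≟_)
open import Data.Fin.Properties using (punchIn-punchOut; punchInᵢ≢i)
open import Data.Product using (Σ; ∃; ∃-syntax; _×_; _,_; proj₁; proj₂)
open import Data.Sum using (_⊎_; inj₁; inj₂; [_,_])
open import Function using (_∘_)
open import Function.Bundles using (Equivalence; _⇔_; mk⇔)
open import Relation.Nullary using (¬_; Dec; yes; no; does; contradiction)
open import Relation.Nullary.Decidable using (_×-dec_; _⊎-dec_)
open import Relation.Unary using (Decidable; _⊆_)
open import Relation.Unary.Properties using (_∩?_; _∪?_)
open import Relation.Binary using (tri<; tri≈; tri>; DecidableEquality)
open import Relation.Binary.PropositionalEquality
  using (_≡_; _≢_; refl; sym; trans; cong; cong₂; subst; subst₂; module ≡-Reasoning)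

module Counting where
  open import Data.Nat using (_+_; _*_)
  open import Data.Nat.Properties using (+-cancelˡ-≡; +-commutativeSemigroup; +-0-commutativeMonoid)
  open import Algebra.Properties.CommutativeSemigroup +-commutativeSemigroup
    using (x∙yz≈y∙xz; interchange)
  open import Algebra.Properties.CommutativeMonoid.Sum +-0-commutativeMonoid
    using (sum-cong-≗; ∑-comm) renaming (sum to ∑ℕ)

  ι : ∀ {A : Set} → Dec A → ℕ
  ι A? = if does A? then 1 else 0

  ∣_∣ : ∀ {n} {P : Fin n → Set} → Decidable P → ℕ
  ∣ P? ∣ = count (does ∘ P?)

  private
    variable
      n : ℕ
      P Q : Fin n → Set

  count-mono : (P? : Decidable P) (Q? : Decidable Q) → P ⊆ Q → ∣ P? ∣ ≤ ∣ Q? ∣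
  count-mono {zero}  P? Q? P⊆Q = z≤n
  count-mono {suc n} P? Q? P⊆Q with P? zero | Q? zero | count-mono (P? ∘ suc) (Q? ∘ suc) P⊆Q
  ... | yes _ | yes _ | rest = s≤s rest
  ... | yes p | no ¬q | _    = contradiction (P⊆Q p) ¬q
  ... | no _  | yes _ | rest = m≤n⇒m≤1+n rest
  ... | no _  | no _  | rest = rest

  count-cong : (P? : Decidable P) (Q? : Decidable Q) → P ⊆ Q → Q ⊆ P → ∣ P? ∣ ≡ ∣ Q? ∣
  count-cong P? Q? P⊆Q Q⊆P = ≤-antisym (count-mono P? Q? P⊆Q) (count-mono Q? P? Q⊆P)

  count-punchIn : (P? : Decidable P) (z : Fin (suc n)) →
                  ∣ P? ∣ ≡ ι (P? z) + ∣ P? ∘ punchIn z ∣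
  count-punchIn         P? zero    = refl
  count-punchIn {suc n} P? (suc z) = trans (cong (ι (P? zero) +_) (count-punchIn (P? ∘ suc) z))
                                           (x∙yz≈y∙xz (ι (P? zero)) (ι (P? (suc z))) ∣ P? ∘ suc ∘ punchIn z ∣)

  count≡suc : (P? : Decidable P) {z : Fin (suc n)} → P z → ∣ P? ∣ ≡ suc ∣ P? ∘ punchIn z ∣
  count≡suc P? {z} Pz with P? z | count-punchIn P? z
  ... | yes _ | e = e
  ... | no ¬Pz | _ = contradiction Pz ¬Pz

  count≡0 : (P? : Decidable P) → (∀ z → ¬ P z) → ∣ P? ∣ ≡ 0
  count≡0 {zero}  P? ∅ = refl
  count≡0 {suc n} P? ∅ with P? zero
  ... | yes Pz = contradiction Pz (∅ zero)
  ... | no _   = count≡0 (P? ∘ suc) (∅ ∘ suc)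

  1≤count : (P? : Decidable P) {z : Fin n} → P z → 1 ≤ ∣ P? ∣
  1≤count {suc n} P? Pz rewrite count≡suc P? Pz = s≤s z≤n

  1≤count⇒∃ : (P? : Decidable P) → 1 ≤ ∣ P? ∣ → ∃ P
  1≤count⇒∃ {suc n} P? pos with P? zero
  ... | yes Pz = zero , Pz
  ... | no _   = let z , Pz = 1≤count⇒∃ (P? ∘ suc) pos in suc z , Pz

  2≤count⇒∃≢ : (P? : Decidable P) → 2 ≤ ∣ P? ∣ → (z : Fin n) → ∃[ z' ] (z' ≢ z × P z')
  2≤count⇒∃≢ {suc n} P? two z = punchIn z k , punchInᵢ≢i z k , Pk
    where
    others : 1 ≤ ∣ P? ∘ punchIn z ∣
    others with P? z | count-punchIn P? z
    ... | yes _ | e = s≤s⁻¹ (subst (2 ≤_) e two)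
    ... | no _  | e = ≤-trans (s≤s z≤n) (subst (2 ≤_) e two)
    k  = proj₁ (1≤count⇒∃ (P? ∘ punchIn z) others)
    Pk = proj₂ (1≤count⇒∃ (P? ∘ punchIn z) others)

  2≤count : (P? : Decidable P) {z z' : Fin n} → P z → P z' → z ≢ z' → 2 ≤ ∣ P? ∣
  2≤count {suc n} {P} P? {z} {z'} Pz Pz' z≢z' rewrite count≡suc P? Pz =
    s≤s (1≤count (P? ∘ punchIn z) (subst P (sym (punchIn-punchOut z≢z')) Pz'))

  count≤1⇒unique : (P? : Decidable P) → ∣ P? ∣ ≤ 1 → ∀ {z z'} → P z → P z' → z ≡ z'
  count≤1⇒unique P? one {z} {z'} Pz Pz' with z ≟ z'
  ... | yes z≡z' = z≡z'
  ... | no z≢z'  = contradiction (≤-trans (2≤count P? Pz Pz' z≢z') one) λ { (s≤s ()) }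

  count≤2⇒pair : (P? : Decidable P) → ∣ P? ∣ ≤ 2 → ∀ {z₁ z₂ z} → z₁ ≢ z₂ → P z₁ → P z₂ → P z →
                 z ≡ z₁ ⊎ z ≡ z₂
  count≤2⇒pair {suc n} {P} P? two {z₁} {z₂} {z} z₁≢z₂ Pz₁ Pz₂ Pz with z ≟ z₁
  ... | yes z≡z₁ = inj₁ z≡z₁
  ... | no z≢z₁  = inj₂ (begin
    z                          ≡⟨ punchIn-punchOut z₁≢z ⟨
    punchIn z₁ (punchOut z₁≢z)  ≡⟨ cong (punchIn z₁) same ⟩
    punchIn z₁ (punchOut z₁≢z₂) ≡⟨ punchIn-punchOut z₁≢z₂ ⟩
    z₂                         ∎)
    where
    open ≡-Reasoning
    z₁≢z = z≢z₁ ∘ sym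
    rest≤1 : ∣ P? ∘ punchIn z₁ ∣ ≤ 1
    rest≤1 = s≤s⁻¹ (subst (_≤ 2) (count≡suc P? Pz₁) two)
    same : punchOut z₁≢z ≡ punchOut z₁≢z₂
    same = count≤1⇒unique (P? ∘ punchIn z₁) rest≤1
             (subst P (sym (punchIn-punchOut z₁≢z)) Pz) (subst P (sym (punchIn-punchOut z₁≢z₂)) Pz₂)

  count≡1 : (P? : Decidable P) {z : Fin n} → P z → (∀ {z'} → P z' → z' ≡ z) → ∣ P? ∣ ≡ 1
  count≡1 {suc n} {P} P? {z} Pz unique = trans (count≡suc P? Pz) (cong suc (count≡0 (P? ∘ punchIn z) other))
    where
    other : ∀ k → ¬ P (punchIn z k)
    other k Pk = punchInᵢ≢i z k (unique Pk)

  count-∩+count-∪ : (P? : Decidable P) (Q? : Decidable Q) →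
                    ∣ P? ∣ + ∣ Q? ∣ ≡ ∣ P? ∩? Q? ∣ + ∣ P? ∪? Q? ∣
  count-∩+count-∪ {zero}  P? Q? = refl
  count-∩+count-∪ {suc n} P? Q? = begin
    (ι P₀ + ∣ P? ∘ suc ∣) + (ι Q₀ + ∣ Q? ∘ suc ∣)      ≡⟨ interchange (ι P₀) _ (ι Q₀) _ ⟩
    (ι P₀ + ι Q₀) + (∣ P? ∘ suc ∣ + ∣ Q? ∘ suc ∣)      ≡⟨ cong₂ _+_ (ι-×+ι-⊎ P₀ Q₀)
                                                                  (count-∩+count-∪ (P? ∘ suc) (Q? ∘ suc)) ⟩
    (ι (P₀ ×-dec Q₀) + ι (P₀ ⊎-dec Q₀)) + (∩ₛ + ∪ₛ)   ≡⟨ interchange (ι (P₀ ×-dec Q₀)) _ ∩ₛ _ ⟩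
    ∣ P? ∩? Q? ∣ + ∣ P? ∪? Q? ∣                        ∎
    where
    open ≡-Reasoning
    P₀ = P? zero
    Q₀ = Q? zero
    ∩ₛ = ∣ (P? ∘ suc) ∩? (Q? ∘ suc) ∣
    ∪ₛ = ∣ (P? ∘ suc) ∪? (Q? ∘ suc) ∣
    ι-×+ι-⊎ : ∀ {A B : Set} (A? : Dec A) (B? : Dec B) → ι A? + ι B? ≡ ι (A? ×-dec B?) + ι (A? ⊎-dec B?)
    ι-×+ι-⊎ A? B? with does A? | does B?
    ... | false | false = refl
    ... | false | true  = refl
    ... | true  | false = refl
    ... | true  | true  = refl

  count≡∑ι : (P? : Decidable P) → ∣ P? ∣ ≡ ∑ℕ (ι ∘ P?)
  count≡∑ι {zero}  P? = refl
  count≡∑ι {suc n} P? = cong (ι (P? zero) +_) (count≡∑ι (P? ∘ suc))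

  ∑-count-comm : ∀ {m n} {P : Fin m → Fin n → Set} (P? : ∀ a b → Dec (P a b)) →
                 ∑ℕ (λ a → ∣ P? a ∣) ≡ ∑ℕ (λ b → ∣ (λ a → P? a b) ∣)
  ∑-count-comm P? = begin
    ∑ℕ (λ a → ∣ P? a ∣)                  ≡⟨ sum-cong-≗ (count≡∑ι ∘ P?) ⟩
    ∑ℕ (λ a → ∑ℕ (λ b → ι (P? a b)))     ≡⟨ ∑-comm (λ a b → ι (P? a b)) ⟩
    ∑ℕ (λ b → ∑ℕ (λ a → ι (P? a b)))     ≡⟨ sum-cong-≗ (λ b → count≡∑ι (λ a → P? a b)) ⟨
    ∑ℕ (λ b → ∣ (λ a → P? a b) ∣)        ∎
    where open ≡-Reasoning

  ∑-const : ∀ n k → ∑ℕ {n} (λ _ → k) ≡ n * k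
  ∑-const zero    k = refl
  ∑-const (suc n) k = cong (k +_) (∑-const n k)

  fibres-punchIn : ∀ {m} {Lab : Set} (_≟ₗ_ : DecidableEquality Lab) (L L' : Fin (suc m) → Lab) →
    (∀ q → ∣ (λ c → L c ≟ₗ q) ∣ ≡ ∣ (λ c → L' c ≟ₗ q) ∣) → ∀ {c'} → L' c' ≡ L zero →
    ∀ q → ∣ (λ c → L (suc c) ≟ₗ q) ∣ ≡ ∣ (λ c → L' (punchIn c' c) ≟ₗ q) ∣
  fibres-punchIn _≟ₗ_ L L' fibres {c'} L'c'≡L₀ q = +-cancelˡ-≡ (ι (L zero ≟ₗ q)) _ _ (begin
    ι (L zero ≟ₗ q) + ∣ (λ c → L (suc c) ≟ₗ q) ∣          ≡⟨ fibres q ⟩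
    ∣ (λ c → L' c ≟ₗ q) ∣                                  ≡⟨ count-punchIn (λ c → L' c ≟ₗ q) c' ⟩
    ι (L' c' ≟ₗ q) + rest                                   ≡⟨ cong (λ l → ι (l ≟ₗ q) + rest) L'c'≡L₀ ⟩
    ι (L zero ≟ₗ q) + rest                                  ∎)
    where
    open ≡-Reasoning
    rest = ∣ (λ c → L' (punchIn c' c) ≟ₗ q) ∣

open Counting

module IntersectionNumbers {n d : ℕ} (S : AssociationScheme n d) where
  open import Data.Nat using (_*_)
  open import Data.Nat.Properties using (*-cancelˡ-≡; +-0-commutativeMonoid)
  open import Algebra.Properties.CommutativeMonoid.Sum +-0-commutativeMonoid
    using (sum-cong-≗) renaming (sum to ∑ℕ)
  open AssociationScheme S

  ′-involutive : ∀ i → (i ′) ′ ≡ i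
  ′-involutive i with nonempty i
  ... | m , m' , refl = begin
    (rel m m' ′) ′  ≡⟨ cong _′ (transpose m m') ⟨
    rel m' m ′      ≡⟨ transpose m' m ⟨
    rel m m'        ∎
    where open ≡-Reasoning

  ′-injective : ∀ {i j} → i ′ ≡ j ′ → i ≡ j
  ′-injective {i} {j} e = trans (sym (′-involutive i)) (trans (cong _′ e) (′-involutive j))

  rel-′ : ∀ {a c j} → rel a c ≡ j → rel c a ≡ j ′
  rel-′ {a} {c} refl = transpose a c

  rel-′⁻ : ∀ {a c j} → rel c a ≡ j ′ → rel a c ≡ j
  rel-′⁻ {a} {c} e = ′-injective (trans (sym (transpose a c)) e)

  module _ {m m' : Fin n} {i j k : Fin (suc d)} (mm'∈k : rel m m' ≡ k) where

    through? : Decidable (λ c → rel m c ≡ i × rel c m' ≡ j)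
    through? c = rel m c ≟ i ×-dec rel c m' ≟ j

    count≡p : ∣ through? ∣ ≡ p i j k
    count≡p = trans (p-spec i j m m') (cong (p i j) mm'∈k)

    1≤p : ∀ {c} → rel m c ≡ i → rel c m' ≡ j → 1 ≤ p i j k
    1≤p mc∈i cm'∈j = subst (1 ≤_) count≡p (1≤count through? (mc∈i , cm'∈j))

    1≤p⇒∃ : 1 ≤ p i j k → ∃[ c ] (rel m c ≡ i × rel c m' ≡ j)
    1≤p⇒∃ pos = 1≤count⇒∃ through? (subst (1 ≤_) (sym count≡p) pos)

    p≤1⇒unique : p i j k ≤ 1 → ∀ {c c'} → rel m c ≡ i × rel c m' ≡ j → rel m c' ≡ i × rel c' m' ≡ j → c ≡ c'
    p≤1⇒unique p≤1 = count≤1⇒unique through? (subst (_≤ 1) (sym count≡p) p≤1)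

    p≡1 : ∀ {c} → rel m c ≡ i × rel c m' ≡ j → (∀ {c'} → rel m c' ≡ i × rel c' m' ≡ j → c' ≡ c) → p i j k ≡ 1
    p≡1 c∈ unique = trans (sym count≡p) (count≡1 through? c∈ unique)

  valency≡p : ∀ m j → valency S m j ≡ p j (j ′) zero
  valency≡p m j = trans (count-cong (λ c → rel m c ≟ j) (through? mm∈0) (λ e → e , rel-′ e) proj₁) (count≡p mm∈0)
    where
    mm∈0 : rel m m ≡ zero
    mm∈0 = Equivalence.from (diagonal m m) refl

  valency-cong : ∀ m m' j → valency S m j ≡ valency S m' j
  valency-cong m m' j = trans (valency≡p m j) (sym (valency≡p m' j))

  valency-′ : ∀ m j → valency S m (j ′) ≡ valency S m j
  valency-′ m j = *-cancelˡ-≡ (valency S m (j ′)) (valency S m j) n {{nonZero m}} (begin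
    n * valency S m (j ′)                ≡⟨ ∑-const n _ ⟨
    ∑ₓ (λ a → valency S m (j ′))         ≡⟨ sum-cong-≗ (λ a → valency-cong m a (j ′)) ⟩
    ∑ₓ (λ a → valency S a (j ′))         ≡⟨ ∑-count-comm (λ a b → rel a b ≟ j ′) ⟩
    ∑ₓ (λ b → ∣ (λ a → rel a b ≟ j ′) ∣) ≡⟨ sum-cong-≗ (λ b →
                                               count-cong (λ a → rel a b ≟ j ′) (λ a → rel b a ≟ j) rel-′⁻ rel-′) ⟩
    ∑ₓ (λ b → valency S b j)             ≡⟨ sum-cong-≗ (λ b → valency-cong b m j) ⟩
    ∑ₓ (λ b → valency S m j)             ≡⟨ ∑-const n _ ⟩
    n * valency S m j                    ∎)
    where
    open ≡-Reasoning
    ∑ₓ : (Fin n → ℕ) → ℕ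
    ∑ₓ = ∑ℕ
    nonZero : Fin n → NonZero n
    nonZero zero    = _
    nonZero (suc _) = _

  prodSize≡1 : ∀ {m a b i s} → rel m a ≡ i → rel m b ≡ s →
               (∀ {b'} → rel m b' ≡ s → rel a b' ≡ rel a b) → prodSize S (i ′) s ≡ 1
  prodSize≡1 {m} {a} {b} {i} {s} ma∈i mb∈s row =
    count≡1 (λ k → 1 ≤? p (i ′) s k) (1≤p refl (rel-′ ma∈i) mb∈s) only
    where
    only : ∀ {k} → 1 ≤ p (i ′) s k → k ≡ rel a b
    only {k} pos with nonempty k
    ... | u , v , uv∈k =
      let y , uy∈i′ , yv∈s = 1≤p⇒∃ uv∈k pos
          b' , mb'∈s , b'a∈k′ = 1≤p⇒∃ ma∈i (1≤p (rel-′⁻ uy∈i′) yv∈s (rel-′ uv∈k))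
      in trans (sym (rel-′⁻ b'a∈k′)) (row mb'∈s)

module Obstructions {n d : ℕ} (S : AssociationScheme n d) (x : Fin n) where
  open AssociationScheme S
  open IntersectionNumbers S

  Obstruction : Set
  Obstruction = ∃[ u ] ∃[ v ] ∃[ w ] ∃[ y ] ∃[ z ]
    ( valency S x u ≡ 2 × valency S x v ≡ 2 × valency S x w ≡ 2
    × valency S x y ≡ 2 × valency S x z ≡ 2
    × p u v w ≡ 1 × p w y z ≡ 1 × prodSize S (u ′) z ≡ 1)

  -- (a₁,b) and (a₂,b) share a cell, but E*_u A_v E*_w · E*_w A_y E*_z (z = rel x b) is 1 at the first and 0 at the second
  record SplitCell : Set where
    field
      u v w y : Fin (suc d)
      a₁ a₂ b c : Fin n
      xa₁∈u : rel x a₁ ≡ u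
      xa₂∈u : rel x a₂ ≡ u
      a₁b≡a₂b : rel a₁ b ≡ rel a₂ b
      xc∈w : rel x c ≡ w
      a₁c∈v : rel a₁ c ≡ v
      a₂c∉v : rel a₂ c ≢ v
      cb∈y : rel c b ≡ y
      c-unique : ∀ {c'} → rel x c' ≡ w → rel c' b ≡ y → c' ≡ c

  obstruction⇒splitCell : Obstruction → SplitCell
  obstruction⇒splitCell (u , v , w , y , z , ku≡2 , _ , _ , _ , kz≡2 , p-uvw≡1 , p-wyz≡1 , product-single) = record
    { u = u ; v = v ; w = w ; y = y ; a₁ = a₁ ; a₂ = a₂ ; b = b ; c = c
    ; xa₁∈u = xa₁∈u ; xa₂∈u = xa₂∈u ; a₁b≡a₂b = same-row xa₁∈u xa₂∈u
    ; xc∈w = xc∈w ; a₁c∈v = a₁c∈v ; cb∈y = cb∈y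
    ; a₂c∉v = λ a₂c∈v → a₂≢a₁ (p≤1⇒unique xc∈w (≤-reflexive p-uvw≡1) (xa₂∈u , a₂c∈v) (xa₁∈u , a₁c∈v))
    ; c-unique = λ xc'∈w c'b∈y → p≤1⇒unique xb∈z (≤-reflexive p-wyz≡1) (xc'∈w , c'b∈y) (xc∈w , cb∈y)
    }
    where
    open Σ (1≤count⇒∃ (λ b → rel x b ≟ z) (subst (1 ≤_) (sym kz≡2) (s≤s z≤n)))
      renaming (proj₁ to b; proj₂ to xb∈z)
    open Σ (1≤p⇒∃ xb∈z (≤-reflexive (sym p-wyz≡1))) renaming (proj₁ to c; proj₂ to c-facts)
    xc∈w = proj₁ c-facts
    cb∈y = proj₂ c-facts
    open Σ (1≤p⇒∃ xc∈w (≤-reflexive (sym p-uvw≡1))) renaming (proj₁ to a₁; proj₂ to a₁-facts)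
    xa₁∈u = proj₁ a₁-facts
    a₁c∈v = proj₂ a₁-facts
    open Σ (2≤count⇒∃≢ (λ a → rel x a ≟ u) (subst (2 ≤_) (sym ku≡2) ≤-refl) a₁)
      renaming (proj₁ to a₂; proj₂ to a₂-facts)
    a₂≢a₁ = proj₁ a₂-facts
    xa₂∈u = proj₂ a₂-facts
    same-row : ∀ {a a'} → rel x a ≡ u → rel x a' ≡ u → rel a b ≡ rel a' b
    same-row xa∈u xa'∈u = count≤1⇒unique (λ k → 1 ≤? p (u ′) z k) (≤-reflexive product-single)
                            (1≤p refl (rel-′ xa∈u) xb∈z) (1≤p refl (rel-′ xa'∈u) xb∈z)

module Arithmetic where
  open import Data.Nat using (_+_)
  open import Data.Nat.Properties using (+-suc; +-comm; +-cancelˡ-≤; +-mono-≤; +-monoˡ-≤; +-monoʳ-≤; module ≤-Reasoning)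

  squeeze : ∀ {N F G K} → K ≤ 2 → N < F → N < G → F + G ≤ N + K → N ≡ 0 × F ≡ 1 × G ≡ 1 × K ≡ 2
  squeeze {N} {F} {G} {K} K≤2 N<F N<G F+G≤N+K with N≡0
    where
    N≡0 : N ≡ 0
    N≡0 = n≤0⇒n≡0 (≤-pred (≤-pred (+-cancelˡ-≤ N _ _ (begin
      N + suc (suc N)  ≡⟨ +-suc N (suc N) ⟩
      suc N + suc N    ≤⟨ +-mono-≤ N<F N<G ⟩
      F + G            ≤⟨ F+G≤N+K ⟩
      N + K            ≤⟨ +-monoʳ-≤ N K≤2 ⟩
      N + 2            ∎))))
      where open ≤-Reasoning
  ... | refl = refl , F≡1 , G≡1 , K≡2
    where
    F≡1 : F ≡ 1
    F≡1 = ≤-antisym (≤-pred (subst (_≤ 2) (+-comm F 1) (≤-trans (+-monoʳ-≤ F N<G) (≤-trans F+G≤N+K K≤2)))) N<F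
    G≡1 : G ≡ 1
    G≡1 = ≤-antisym (≤-pred (≤-trans (+-monoˡ-≤ G N<F) (≤-trans F+G≤N+K K≤2))) N<G
    K≡2 : K ≡ 2
    K≡2 = ≤-antisym K≤2 (≤-trans (+-mono-≤ N<F N<G) F+G≤N+K)
open Arithmetic

module QuasiThinScheme {n d : ℕ} (S : AssociationScheme n d) (x : Fin n) (qt : QuasiThin S x) where
  open import Data.Nat using (_+_)
  open import Data.Nat.Properties using (+-mono-≤; module ≤-Reasoning)
  open AssociationScheme S
  open IntersectionNumbers S
  open Obstructions S x

  valency≡2 : ∀ {m u v k} → rel m u ≡ k → rel m v ≡ k → u ≢ v → valency S x k ≡ 2
  valency≡2 {m} {k = k} mu∈k mv∈k u≢v =
    ≤-antisym (qt k) (subst (2 ≤_) (valency-cong m x k) (2≤count (λ z → rel m z ≟ k) mu∈k mv∈k u≢v))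

  in-pair : ∀ {u v z k} → u ≢ v → rel x u ≡ k → rel x v ≡ k → rel x z ≡ k → z ≡ u ⊎ z ≡ v
  in-pair {k = k} = count≤2⇒pair (λ z → rel x z ≟ k) (qt k)

  Triple : Fin n → Fin n → Fin (suc d) → Fin (suc d) → Fin (suc d) → Fin n → Set
  Triple a b l j r c = rel x c ≡ l × rel a c ≡ j × rel c b ≡ r

  triple? : ∀ a b l j r → Decidable (Triple a b l j r)
  triple? a b l j r c = rel x c ≟ l ×-dec rel a c ≟ j ×-dec rel c b ≟ r

  triple≤pˡ : ∀ {a b k} l j r → rel x a ≡ k → ∣ triple? a b l j r ∣ ≤ p l (j ′) k
  triple≤pˡ {a} {b} l j r xa∈k =
    subst (∣ triple? a b l j r ∣ ≤_) (count≡p xa∈k)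
          (count-mono (triple? a b l j r) (through? xa∈k) λ (xc∈l , ac∈j , _) → xc∈l , rel-′ ac∈j)

  triple≤pʳ : ∀ {a b k} l j r → rel x b ≡ k → ∣ triple? a b l j r ∣ ≤ p l r k
  triple≤pʳ {a} {b} l j r xb∈k =
    subst (∣ triple? a b l j r ∣ ≤_) (count≡p xb∈k)
          (count-mono (triple? a b l j r) (through? xb∈k) λ (xc∈l , _ , cb∈r) → xc∈l , cb∈r)

  p+p≤triple+valency : ∀ a b l j r → p l (j ′) (rel x a) + p l r (rel x b) ≤ ∣ triple? a b l j r ∣ + valency S x l
  p+p≤triple+valency a b l j r = begin
    p l (j ′) (rel x a) + p l r (rel x b)  ≡⟨ cong₂ _+_ (count≡p refl) (count≡p refl) ⟨
    ∣ L? ∣ + ∣ R? ∣                        ≡⟨ count-∩+count-∪ L? R? ⟩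
    ∣ L? ∩? R? ∣ + ∣ L? ∪? R? ∣            ≤⟨ +-mono-≤ (≤-reflexive (count-cong (L? ∩? R?) (triple? a b l j r) L∩R⊆T T⊆L∩R))
                                                      (count-mono (L? ∪? R?) (λ c → rel x c ≟ l) [ proj₁ , proj₁ ]) ⟩
    ∣ triple? a b l j r ∣ + valency S x l  ∎
    where
    open ≤-Reasoning
    L? = through? {i = l} {j = j ′} (refl {x = rel x a})
    R? = through? {i = l} {j = r} (refl {x = rel x b})
    L∩R⊆T : ∀ {c} → (rel x c ≡ l × rel c a ≡ j ′) × (rel x c ≡ l × rel c b ≡ r) → Triple a b l j r c
    L∩R⊆T ((xc∈l , ca∈j′) , (_ , cb∈r)) = xc∈l , rel-′⁻ ca∈j′ , cb∈r
    T⊆L∩R : ∀ {c} → Triple a b l j r c → (rel x c ≡ l × rel c a ≡ j ′) × (rel x c ≡ l × rel c b ≡ r)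
    T⊆L∩R (xc∈l , ac∈j , cb∈r) = (xc∈l , rel-′ ac∈j) , (xc∈l , cb∈r)

  module BadPair
    {a₀ b₀ a₁ b₁ c₁ : Fin n} {l j r : Fin (suc d)}
    (xa₁∈i : rel x a₁ ≡ rel x a₀) (a₁b₁∈t : rel a₁ b₁ ≡ rel a₀ b₀) (xb₁∈s : rel x b₁ ≡ rel x b₀)
    (xc₁∈l : rel x c₁ ≡ l) (a₁c₁∈j : rel a₁ c₁ ≡ j) (c₁b₁∈r : rel c₁ b₁ ≡ r)
    (no-c₀ : ∀ {c} → ¬ Triple a₀ b₀ l j r c)
    (pˡ≡1 : p l (j ′) (rel x a₀) ≡ 1) (pʳ≡1 : p l r (rel x b₀) ≡ 1) (kₗ≡2 : valency S x l ≡ 2)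
    where

    i t s : Fin (suc d)
    i = rel x a₀
    t = rel a₀ b₀
    s = rel x b₀

    left-unique : ∀ {a c c'} → rel x a ≡ i → rel x c ≡ l → rel a c ≡ j → rel x c' ≡ l → rel a c' ≡ j → c ≡ c'
    left-unique xa∈i xc∈l ac∈j xc'∈l ac'∈j =
      p≤1⇒unique xa∈i (≤-reflexive pˡ≡1) (xc∈l , rel-′ ac∈j) (xc'∈l , rel-′ ac'∈j)

    right-unique : ∀ {b c c'} → rel x b ≡ s → rel x c ≡ l → rel c b ≡ r → rel x c' ≡ l → rel c' b ≡ r → c ≡ c'
    right-unique xb∈s xc∈l cb∈r xc'∈l c'b∈r = p≤1⇒unique xb∈s (≤-reflexive pʳ≡1) (xc∈l , cb∈r) (xc'∈l , c'b∈r)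

    open Σ (1≤p⇒∃ {i = l} {j = j ′} refl (≤-reflexive (sym pˡ≡1))) renaming (proj₁ to cᵃ; proj₂ to cᵃ-facts)
    open Σ (1≤p⇒∃ {i = l} {j = r} refl (≤-reflexive (sym pʳ≡1))) renaming (proj₁ to cᵇ; proj₂ to cᵇ-facts)

    xcᵃ∈l : rel x cᵃ ≡ l
    xcᵃ∈l = proj₁ cᵃ-facts
    a₀cᵃ∈j : rel a₀ cᵃ ≡ j
    a₀cᵃ∈j = rel-′⁻ (proj₂ cᵃ-facts)
    xcᵇ∈l : rel x cᵇ ≡ l
    xcᵇ∈l = proj₁ cᵇ-facts
    cᵇb₀∈r : rel cᵇ b₀ ≡ r
    cᵇb₀∈r = proj₂ cᵇ-facts

    cᵃ≢cᵇ : cᵃ ≢ cᵇ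
    cᵃ≢cᵇ cᵃ≡cᵇ = no-c₀ (xcᵃ∈l , a₀cᵃ∈j , subst (λ c → rel c b₀ ≡ r) (sym cᵃ≡cᵇ) cᵇb₀∈r)

    open Σ (1≤p⇒∃ xcᵇ∈l (1≤p xc₁∈l xa₁∈i a₁c₁∈j)) renaming (proj₁ to a₂; proj₂ to a₂-facts)
    open Σ (1≤p⇒∃ xcᵃ∈l (1≤p xc₁∈l xb₁∈s (rel-′ c₁b₁∈r))) renaming (proj₁ to b₂; proj₂ to b₂-facts)

    xa₂∈i : rel x a₂ ≡ i
    xa₂∈i = proj₁ a₂-facts
    a₂cᵇ∈j : rel a₂ cᵇ ≡ j
    a₂cᵇ∈j = proj₂ a₂-facts
    xb₂∈s : rel x b₂ ≡ s
    xb₂∈s = proj₁ b₂-facts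
    cᵃb₂∈r : rel cᵃ b₂ ≡ r
    cᵃb₂∈r = rel-′⁻ (proj₂ b₂-facts)

    a₀≢a₂ : a₀ ≢ a₂
    a₀≢a₂ a₀≡a₂ = cᵃ≢cᵇ (left-unique refl xcᵃ∈l a₀cᵃ∈j xcᵇ∈l (subst (λ a → rel a cᵇ ≡ j) (sym a₀≡a₂) a₂cᵇ∈j))

    b₀≢b₂ : b₀ ≢ b₂
    b₀≢b₂ b₀≡b₂ = cᵃ≢cᵇ (right-unique refl xcᵃ∈l (subst (λ b → rel cᵃ b ≡ r) (sym b₀≡b₂) cᵃb₂∈r) xcᵇ∈l cᵇb₀∈r)

    kᵢ≡2 : valency S x i ≡ 2
    kᵢ≡2 = valency≡2 refl xa₂∈i a₀≢a₂

    kₛ≡2 : valency S x s ≡ 2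
    kₛ≡2 = valency≡2 refl xb₂∈s b₀≢b₂

    p-ijl≡1 : p i j l ≡ 1
    p-ijl≡1 = p≡1 xcᵇ∈l (xa₂∈i , a₂cᵇ∈j) only
      where
      only : ∀ {a} → rel x a ≡ i × rel a cᵇ ≡ j → a ≡ a₂
      only {a} (xa∈i , acᵇ∈j) with in-pair a₀≢a₂ refl xa₂∈i xa∈i
      ... | inj₁ a≡a₀ = contradiction (left-unique refl xcᵃ∈l a₀cᵃ∈j xcᵇ∈l (subst (λ a → rel a cᵇ ≡ j) a≡a₀ acᵇ∈j)) cᵃ≢cᵇ
      ... | inj₂ a≡a₂ = a≡a₂

    -- both members of xR_i are R_t-related to b₀, and p^s_{it} transports this to b₂
    a₂b₀∈t⇒a₀b₂∈t : rel a₂ b₀ ≡ t → rel a₀ b₂ ≡ t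
    a₂b₀∈t⇒a₀b₂∈t a₂b₀∈t with 2≤count⇒∃≢ (through? {i = i} {j = t} xb₂∈s) two-at-b₂ a₂
      where
      two-at-b₂ : 2 ≤ ∣ through? {i = i} {j = t} xb₂∈s ∣
      two-at-b₂ = subst (2 ≤_) (trans (count≡p refl) (sym (count≡p xb₂∈s)))
                    (2≤count (through? {i = i} {j = t} refl) (refl , refl) (xa₂∈i , a₂b₀∈t) a₀≢a₂)
    ... | a , a≢a₂ , xa∈i , ab₂∈t with in-pair a₀≢a₂ refl xa₂∈i xa∈i
    ...   | inj₁ a≡a₀ = subst (λ a → rel a b₂ ≡ t) a≡a₀ ab₂∈t
    ...   | inj₂ a≡a₂ = contradiction a≡a₂ a≢a₂

    a₀b₂∈t : rel a₀ b₂ ≡ t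
    a₀b₂∈t with in-pair a₀≢a₂ refl xa₂∈i xa₁∈i | in-pair b₀≢b₂ refl xb₂∈s xb₁∈s
    ... | inj₁ a₁≡a₀ | inj₁ b₁≡b₀ = contradiction
      (trans (left-unique refl xcᵃ∈l a₀cᵃ∈j xc₁∈l (subst (λ a → rel a c₁ ≡ j) a₁≡a₀ a₁c₁∈j))
             (right-unique refl xc₁∈l (subst (λ b → rel c₁ b ≡ r) b₁≡b₀ c₁b₁∈r) xcᵇ∈l cᵇb₀∈r)) cᵃ≢cᵇ
    ... | inj₁ a₁≡a₀ | inj₂ b₁≡b₂ = subst₂ (λ a b → rel a b ≡ t) a₁≡a₀ b₁≡b₂ a₁b₁∈t
    ... | inj₂ a₁≡a₂ | inj₁ b₁≡b₀ = a₂b₀∈t⇒a₀b₂∈t (subst₂ (λ a b → rel a b ≡ t) a₁≡a₂ b₁≡b₀ a₁b₁∈t)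
    ... | inj₂ a₁≡a₂ | inj₂ b₁≡b₂ = contradiction
      (trans (right-unique xb₂∈s xcᵃ∈l cᵃb₂∈r xc₁∈l (subst (λ b → rel c₁ b ≡ r) b₁≡b₂ c₁b₁∈r))
             (left-unique xa₂∈i xc₁∈l (subst (λ a → rel a c₁ ≡ j) a₁≡a₂ a₁c₁∈j) xcᵇ∈l a₂cᵇ∈j)) cᵃ≢cᵇ

    row : ∀ {b} → rel x b ≡ s → rel a₀ b ≡ t
    row xb∈s with in-pair b₀≢b₂ refl xb₂∈s xb∈s
    ... | inj₁ b≡b₀ = cong (rel a₀) b≡b₀
    ... | inj₂ b≡b₂ = trans (cong (rel a₀) b≡b₂) a₀b₂∈t

    open Σ (1≤p⇒∃ refl (1≤p a₀b₂∈t a₀cᵃ∈j cᵃb₂∈r)) renaming (proj₁ to c₂; proj₂ to c₂-facts)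

    a₀c₂∈j : rel a₀ c₂ ≡ j
    a₀c₂∈j = proj₁ c₂-facts
    c₂b₀∈r : rel c₂ b₀ ≡ r
    c₂b₀∈r = proj₂ c₂-facts

    kⱼ≡2 : valency S x j ≡ 2
    kⱼ≡2 = valency≡2 a₀cᵃ∈j a₀c₂∈j λ cᵃ≡c₂ →
      cᵃ≢cᵇ (right-unique refl xcᵃ∈l (subst (λ c → rel c b₀ ≡ r) (sym cᵃ≡c₂) c₂b₀∈r) xcᵇ∈l cᵇb₀∈r)

    kᵣ≡2 : valency S x r ≡ 2
    kᵣ≡2 = trans (sym (valency-′ x r)) (valency≡2 (rel-′ cᵇb₀∈r) (rel-′ c₂b₀∈r) λ cᵇ≡c₂ →
      cᵃ≢cᵇ (left-unique refl xcᵃ∈l a₀cᵃ∈j xcᵇ∈l (subst (λ c → rel a₀ c ≡ j) (sym cᵇ≡c₂) a₀c₂∈j)))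

    obstruction : Obstruction
    obstruction = i , j , l , r , s , kᵢ≡2 , kⱼ≡2 , kₗ≡2 , kᵣ≡2 , kₛ≡2 , p-ijl≡1 , pʳ≡1 , prodSize≡1 refl refl row

  unequal-triples⇒obstruction : ∀ {a₀ b₀ a₁ b₁ l j r} →
    rel x a₁ ≡ rel x a₀ → rel a₁ b₁ ≡ rel a₀ b₀ → rel x b₁ ≡ rel x b₀ →
    ∣ triple? a₀ b₀ l j r ∣ < ∣ triple? a₁ b₁ l j r ∣ → Obstruction
  unequal-triples⇒obstruction {a₀} {b₀} {a₁} {b₁} {l} {j} {r} xa₁∈i a₁b₁∈t xb₁∈s lt
    with squeeze (qt l) (<-≤-trans lt (triple≤pˡ l j r xa₁∈i)) (<-≤-trans lt (triple≤pʳ l j r xb₁∈s))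
                        (p+p≤triple+valency a₀ b₀ l j r)
  ... | N≡0 , pˡ≡1 , pʳ≡1 , kₗ≡2 =
    let c₁ , xc₁∈l , a₁c₁∈j , c₁b₁∈r = 1≤count⇒∃ (triple? a₁ b₁ l j r) (subst (_< _) N≡0 lt)
    in BadPair.obstruction xa₁∈i a₁b₁∈t xb₁∈s xc₁∈l a₁c₁∈j c₁b₁∈r no-c₀ pˡ≡1 pʳ≡1 kₗ≡2
    where
    no-c₀ : ∀ {c} → ¬ Triple a₀ b₀ l j r c
    no-c₀ c∈ = contradiction (subst (1 ≤_) N≡0 (1≤count (triple? a₀ b₀ l j r) c∈)) λ ()

  triple-count-invariant : ¬ Obstruction → ∀ {a b a' b'} →
    rel x a ≡ rel x a' → rel a b ≡ rel a' b' → rel x b ≡ rel x b' →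
    ∀ l j r → ∣ triple? a b l j r ∣ ≡ ∣ triple? a' b' l j r ∣
  triple-count-invariant no-obstruction {a} {b} {a'} {b'} xa≡xa' ab≡a'b' xb≡xb' l j r
    with <-cmp ∣ triple? a b l j r ∣ ∣ triple? a' b' l j r ∣
  ... | tri< lt _ _ = contradiction (unequal-triples⇒obstruction (sym xa≡xa') (sym ab≡a'b') (sym xb≡xb') lt) no-obstruction
  ... | tri≈ _ eq _ = eq
  ... | tri> _ _ gt = contradiction (unequal-triples⇒obstruction xa≡xa' ab≡a'b' xb≡xb' gt) no-obstruction

module FiniteSums {ℓᶜ ℓ : Level} (F : Field ℓᶜ ℓ) where
  open Field F hiding (zero) renaming (refl to ≈-refl; sym to ≈-sym; trans to ≈-trans; reflexive to ≈-reflexive)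
  open Matrices F
  open import Relation.Binary.Reasoning.Setoid setoid
  open import Algebra.Properties.Semiring.Sum semiring using (sum; sum-cong-≋; sum-remove; sum-replicate-zero)

  ∑≡sum : ∀ {m} (f : Fin m → Carrier) → ∑[ f ] ≡ sum f
  ∑≡sum {zero}  f = refl
  ∑≡sum {suc m} f = cong (f zero +_) (∑≡sum (f ∘ suc))

  ∑-cong : ∀ {m} {f g : Fin m → Carrier} → (∀ i → f i ≈ g i) → ∑[ f ] ≈ ∑[ g ]
  ∑-cong {f = f} {g} f≈g = begin
    ∑[ f ]  ≡⟨ ∑≡sum f ⟩
    sum f   ≈⟨ sum-cong-≋ f≈g ⟩
    sum g   ≡⟨ ∑≡sum g ⟨
    ∑[ g ]  ∎

  ∑-zero : ∀ {m} {f : Fin m → Carrier} → (∀ i → f i ≈ 0#) → ∑[ f ] ≈ 0#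
  ∑-zero {m} {f} f≈0 = begin
    ∑[ f ]       ≈⟨ ∑-cong f≈0 ⟩
    ∑[ zeros ]   ≡⟨ ∑≡sum zeros ⟩
    sum zeros    ≈⟨ sum-replicate-zero m ⟩
    0#           ∎
    where
    zeros : Fin m → Carrier
    zeros _ = 0#

  ∑-remove : ∀ {m} {f : Fin (suc m) → Carrier} (k : Fin (suc m)) → ∑[ f ] ≈ f k + ∑[ f ∘ punchIn k ]
  ∑-remove {m} {f} k = begin
    ∑[ f ]                       ≡⟨ ∑≡sum f ⟩
    sum f                        ≈⟨ sum-remove f ⟩
    f k + sum (f ∘ punchIn k)    ≡⟨ cong (f k +_) (∑≡sum (f ∘ punchIn k)) ⟨
    f k + ∑[ f ∘ punchIn k ]     ∎

  ∑-single : ∀ {m} {f : Fin m → Carrier} (k : Fin m) → (∀ i → i ≢ k → f i ≈ 0#) → ∑[ f ] ≈ f k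
  ∑-single {suc m} {f} k others = begin
    ∑[ f ]                    ≈⟨ ∑-remove {f = f} k ⟩
    f k + ∑[ f ∘ punchIn k ]  ≈⟨ +-congˡ (∑-zero {m} (λ i → others (punchIn k i) (punchInᵢ≢i k i))) ⟩
    f k + 0#                  ≈⟨ +-identityʳ (f k) ⟩
    f k                       ∎

  ∑-fibrewise : ∀ {m} {f g : Fin m → Carrier} {Lab : Set} (_≟ₗ_ : DecidableEquality Lab) (L L' : Fin m → Lab) →
    (∀ q → ∣ (λ c → L c ≟ₗ q) ∣ ≡ ∣ (λ c → L' c ≟ₗ q) ∣) →
    (∀ {c c'} → L c ≡ L' c' → f c ≈ g c') → ∑[ f ] ≈ ∑[ g ]
  ∑-fibrewise {zero}          _≟ₗ_ L L' fibres f≈g = ≈-refl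
  ∑-fibrewise {suc m} {f} {g} _≟ₗ_ L L' fibres f≈g = begin
    f zero + ∑[ f ∘ suc ]       ≈⟨ +-cong (f≈g (sym L'c'≡L₀))
                                          (∑-fibrewise _≟ₗ_ (L ∘ suc) (L' ∘ punchIn c')
                                                       (fibres-punchIn _≟ₗ_ L L' fibres L'c'≡L₀) f≈g) ⟩
    g c' + ∑[ g ∘ punchIn c' ]  ≈⟨ ∑-remove {f = g} c' ⟨
    ∑[ g ]                      ∎
    where
    open Σ (1≤count⇒∃ (λ c → L' c ≟ₗ L zero) (subst (1 ≤_) (fibres (L zero)) (1≤count (λ c → L c ≟ₗ L zero) refl)))
      renaming (proj₁ to c'; proj₂ to L'c'≡L₀)

module T₀ {ℓᶜ ℓ : Level} (F : Field ℓᶜ ℓ) {n d : ℕ} (S : AssociationScheme n d) (x : Fin n) where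
  open Field F hiding (zero) renaming (refl to ≈-refl; sym to ≈-sym; trans to ≈-trans; reflexive to ≈-reflexive)
  open Matrices F
  open FiniteSums F
  open AssociationScheme S using (rel; diagonal)
  open Obstructions S x
  open import Relation.Binary.Reasoning.Setoid setoid
  open import Relation.Nullary.Decidable using (dec-true; dec-false; does-⇔; map′)
  open import Data.Fin.Properties using (any?)

  δ : ∀ {A : Set} → Dec A → Carrier
  δ A? = if does A? then 1# else 0#

  δ-yes : ∀ {A : Set} (A? : Dec A) → A → δ A? ≈ 1#
  δ-yes A? a = ≈-reflexive (cong (λ b → if b then 1# else 0#) (dec-true A? a))

  δ-no : ∀ {A : Set} (A? : Dec A) → ¬ A → δ A? ≈ 0#
  δ-no A? ¬a = ≈-reflexive (cong (λ b → if b then 1# else 0#) (dec-false A? ¬a))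

  δ-× : ∀ {A B : Set} (A? : Dec A) (B? : Dec B) → δ (A? ×-dec B?) ≈ δ A? * δ B?
  δ-× A? B? with does A?
  ... | true  = ≈-sym (*-identityˡ (δ B?))
  ... | false = ≈-sym (zeroˡ (δ B?))

  Diagonal : Mat n → Set ℓ
  Diagonal D = ∀ {a b} → a ≢ b → D a b ≈ 0#

  ·-diagonalʳ : ∀ {M D} → Diagonal D → ∀ a b → (M · D) a b ≈ M a b * D b b
  ·-diagonalʳ D-diag a b = ∑-single b (λ k k≢b → ≈-trans (*-congˡ (D-diag k≢b)) (zeroʳ _))

  ·-diagonalˡ : ∀ {D M} → Diagonal D → ∀ a b → (D · M) a b ≈ D a a * M a b
  ·-diagonalˡ D-diag a b = ∑-single a (λ k k≢a → ≈-trans (*-congʳ (D-diag (k≢a ∘ sym))) (zeroˡ _))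

  E*-diagonal : ∀ i → Diagonal (E* S x i)
  E*-diagonal i {a} {b} a≢b = δ-no (a ≟ b ×-dec rel x a ≟ i) (a≢b ∘ proj₁)

  E*-entry : ∀ i a → E* S x i a a ≈ δ (rel x a ≟ i)
  E*-entry i a = begin
    δ (a ≟ a ×-dec rel x a ≟ i)  ≈⟨ δ-× (a ≟ a) (rel x a ≟ i) ⟩
    δ (a ≟ a) * δ (rel x a ≟ i)  ≈⟨ *-congʳ (δ-yes (a ≟ a) refl) ⟩
    1# * δ (rel x a ≟ i)         ≈⟨ *-identityˡ _ ⟩
    δ (rel x a ≟ i)              ∎

  Cell : Set
  Cell = Fin (suc d) × Fin (suc d) × Fin (suc d)

  cell : Fin n → Fin n → Cell
  cell a b = rel x a , rel a b , rel x b

  cell-components : ∀ {i j l i' j' l'} → _≡_ {A = Cell} (i , j , l) (i' , j' , l') → i ≡ i' × j ≡ j' × l ≡ l'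
  cell-components refl = refl , refl , refl

  components-cell : ∀ {i j l i' j' l'} → i ≡ i' × j ≡ j' × l ≡ l' → _≡_ {A = Cell} (i , j , l) (i' , j' , l')
  components-cell (refl , refl , refl) = refl

  _≟ᶜ_ : DecidableEquality Cell
  (i , j , l) ≟ᶜ (i' , j' , l') = map′ components-cell cell-components (i ≟ i' ×-dec j ≟ j' ×-dec l ≟ l')

  B : Fin (suc d) → Fin (suc d) → Fin (suc d) → Mat n
  B i j l = (E* S x i · A S x j) · E* S x l

  basis-entry : ∀ i j l a b → B i j l a b ≈ δ (cell a b ≟ᶜ (i , j , l))
  basis-entry i j l a b = begin
    B i j l a b                                  ≈⟨ ·-diagonalʳ {M = E* S x i · A S x j} (E*-diagonal l) a b ⟩
    (E* S x i · A S x j) a b * E* S x l b b      ≈⟨ *-cong (·-diagonalˡ {M = A S x j} (E*-diagonal i) a b) (E*-entry l b) ⟩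
    E* S x i a a * A S x j a b * δ (rel x b ≟ l) ≈⟨ *-congʳ (*-congʳ (E*-entry i a)) ⟩
    δ xa? * δ ab? * δ xb?                        ≈⟨ *-assoc _ _ _ ⟩
    δ xa? * (δ ab? * δ xb?)                      ≈⟨ *-congˡ (δ-× ab? xb?) ⟨
    δ xa? * δ (ab? ×-dec xb?)                    ≈⟨ δ-× xa? (ab? ×-dec xb?) ⟨
    δ (cell a b ≟ᶜ (i , j , l))                  ∎
    where
    xa? = rel x a ≟ i
    ab? = rel a b ≟ j
    xb? = rel x b ≟ l

  basis-on : ∀ {i j l a b} → cell a b ≡ (i , j , l) → B i j l a b ≈ 1#
  basis-on {i} {j} {l} {a} {b} e = ≈-trans (basis-entry i j l a b) (δ-yes (cell a b ≟ᶜ (i , j , l)) e)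

  basis-off : ∀ {i j l a b} → cell a b ≢ (i , j , l) → B i j l a b ≈ 0#
  basis-off {i} {j} {l} {a} {b} ne = ≈-trans (basis-entry i j l a b) (δ-no (cell a b ≟ᶜ (i , j , l)) ne)

  CellConstant : Mat n → Set ℓ
  CellConstant M = ∀ {a b a' b'} → cell a b ≡ cell a' b' → M a b ≈ M a' b'

  basis-cellConstant : ∀ i j l → CellConstant (B i j l)
  basis-cellConstant i j l {a} {b} {a'} {b'} same = begin
    B i j l a b                    ≈⟨ basis-entry i j l a b ⟩
    δ (cell a b ≟ᶜ (i , j , l))    ≡⟨ cong (λ q → δ (q ≟ᶜ (i , j , l))) same ⟩
    δ (cell a' b' ≟ᶜ (i , j , l))  ≈⟨ basis-entry i j l a' b' ⟨
    B i j l a' b'                  ∎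

  InT0⇒cellConstant : ∀ {M} → InT0 S x M → CellConstant M
  InT0⇒cellConstant {M} (coef , M≈) {a} {b} {a'} {b'} same = begin
    M a b
      ≈⟨ M≈ a b ⟩
    ∑[ (λ i → ∑[ (λ j → ∑[ (λ l → coef i j l * B i j l a b) ]) ]) ]
      ≈⟨ ∑-cong (λ i → ∑-cong (λ j → ∑-cong (λ l → *-congˡ {coef i j l} (basis-cellConstant i j l same)))) ⟩
    ∑[ (λ i → ∑[ (λ j → ∑[ (λ l → coef i j l * B i j l a' b') ]) ]) ]
      ≈⟨ M≈ a' b' ⟨
    M a' b' ∎

  ∑³-single : (f : Cell → Carrier) (q : Cell) → (∀ q' → q' ≢ q → f q' ≈ 0#) →
              ∑[ (λ i → ∑[ (λ j → ∑[ (λ l → f (i , j , l)) ]) ]) ] ≈ f q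
  ∑³-single f (i , j , l) others = begin
    ∑[ (λ i' → ∑[ (λ j' → ∑[ (λ l' → f (i' , j' , l')) ]) ]) ]
      ≈⟨ ∑-single i (λ i' i'≢i → ∑-zero λ j' → ∑-zero λ l' → others (i' , j' , l') (i'≢i ∘ proj₁ ∘ cell-components)) ⟩
    ∑[ (λ j' → ∑[ (λ l' → f (i , j' , l')) ]) ]
      ≈⟨ ∑-single j (λ j' j'≢j → ∑-zero λ l' → others (i , j' , l') (j'≢j ∘ proj₁ ∘ proj₂ ∘ cell-components)) ⟩
    ∑[ (λ l' → f (i , j , l')) ]
      ≈⟨ ∑-single l (λ l' l'≢l → others (i , j , l') (l'≢l ∘ proj₂ ∘ proj₂ ∘ cell-components)) ⟩
    f (i , j , l) ∎

  -- the value of M at some pair of the cell q, or 0 if q contains no pair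
  coefficient : Mat n → Cell → Carrier
  coefficient M q with any? (λ a → any? (λ b → cell a b ≟ᶜ q))
  ... | yes (a , b , _) = M a b
  ... | no _            = 0#

  coefficient-cell : ∀ {M} → CellConstant M → ∀ a b → coefficient M (cell a b) ≈ M a b
  coefficient-cell {M} M-const a b with any? (λ a' → any? (λ b' → cell a' b' ≟ᶜ cell a b))
  ... | yes (a' , b' , same) = M-const same
  ... | no ∄                 = contradiction (a , b , refl) ∄

  cellConstant⇒InT0 : ∀ {M} → CellConstant M → InT0 S x M
  cellConstant⇒InT0 {M} M-const = (λ i j l → coefficient M (i , j , l)) , λ a b → ≈-sym (begin
    ∑[ (λ i → ∑[ (λ j → ∑[ (λ l → coefficient M (i , j , l) * B i j l a b) ]) ]) ]
      ≈⟨ ∑³-single (λ (i , j , l) → coefficient M (i , j , l) * B i j l a b) (cell a b)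
                   (λ (i , j , l) → off-cell a b i j l) ⟩
    coefficient M (cell a b) * B (rel x a) (rel a b) (rel x b) a b
      ≈⟨ *-congˡ (basis-on refl) ⟩
    coefficient M (cell a b) * 1#
      ≈⟨ *-identityʳ _ ⟩
    coefficient M (cell a b)
      ≈⟨ coefficient-cell M-const a b ⟩
    M a b ∎)
    where
    off-cell : ∀ a b i j l → (i , j , l) ≢ cell a b → coefficient M (i , j , l) * B i j l a b ≈ 0#
    off-cell a b i j l ≢cell = ≈-trans (*-congˡ (basis-off (≢cell ∘ sym))) (zeroʳ _)

  I-cellConstant : CellConstant I
  I-cellConstant {a} {b} {a'} {b'} same =
    ≈-reflexive (cong (λ t → if t then 1# else 0#) (does-⇔ (mk⇔ forth back) (a ≟ b) (a' ≟ b')))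
    where
    open Equivalence
    ab≡a'b' = proj₁ (proj₂ (cell-components same))
    forth : a ≡ b → a' ≡ b'
    forth a≡b = to (diagonal a' b') (trans (sym ab≡a'b') (from (diagonal a b) a≡b))
    back : a' ≡ b' → a ≡ b
    back a'≡b' = to (diagonal a b) (trans ab≡a'b' (from (diagonal a' b') a'≡b'))

  ·-cellConstant : QuasiThin S x → ¬ Obstruction → ∀ {M N} → CellConstant M → CellConstant N → CellConstant (M · N)
  ·-cellConstant qt no-obstruction M-const N-const {a} {b} {a'} {b'} same =
    ∑-fibrewise _≟ᶜ_ (label a b) (label a' b')
      (λ (l , j , r) → triple-count-invariant no-obstruction xa≡ ab≡ xb≡ l j r)
      λ labels≡ → let l≡ , j≡ , r≡ = cell-components labels≡
                  in *-cong (M-const (components-cell (xa≡ , j≡ , l≡))) (N-const (components-cell (l≡ , r≡ , xb≡)))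
    where
    open QuasiThinScheme S x qt using (triple-count-invariant)
    label : Fin n → Fin n → Fin n → Cell
    label a b c = rel x c , rel a c , rel c b
    xa≡ = proj₁ (cell-components same)
    ab≡ = proj₁ (proj₂ (cell-components same))
    xb≡ = proj₂ (proj₂ (cell-components same))

  subalgebra⇒no-obstruction : UnitalSubalgebra S x → ¬ Obstruction
  subalgebra⇒no-obstruction (_ , _ , _ , closed-· , _) obstruction = 1≉0 (begin
    1#                           ≈⟨ P-at-a₁ ⟨
    (B u v w · B w y z) a₁ b     ≈⟨ P-const (components-cell (trans xa₁∈u (sym xa₂∈u) , a₁b≡a₂b , refl)) ⟩
    (B u v w · B w y z) a₂ b     ≈⟨ P-at-a₂ ⟩
    0#                           ∎)
    where
    open SplitCell (obstruction⇒splitCell obstruction)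
    z = rel x b
    P-const : CellConstant (B u v w · B w y z)
    P-const = InT0⇒cellConstant (closed-· _ _ (cellConstant⇒InT0 (basis-cellConstant u v w))
                                               (cellConstant⇒InT0 (basis-cellConstant w y z)))
    through-c : ∀ a → (B u v w · B w y z) a b ≈ B u v w a c * B w y z c b
    through-c a = ∑-single c λ c' c'≢c → ≈-trans (*-congˡ (basis-off λ e →
      let xc'∈w , c'b∈y , _ = cell-components e in c'≢c (c-unique xc'∈w c'b∈y))) (zeroʳ _)
    P-at-a₁ : (B u v w · B w y z) a₁ b ≈ 1#
    P-at-a₁ = begin
      (B u v w · B w y z) a₁ b      ≈⟨ through-c a₁ ⟩
      B u v w a₁ c * B w y z c b    ≈⟨ *-cong (basis-on (components-cell (xa₁∈u , a₁c∈v , xc∈w)))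
                                              (basis-on (components-cell (xc∈w , cb∈y , refl))) ⟩
      1# * 1#                       ≈⟨ *-identityˡ 1# ⟩
      1#                            ∎
    P-at-a₂ : (B u v w · B w y z) a₂ b ≈ 0#
    P-at-a₂ = begin
      (B u v w · B w y z) a₂ b      ≈⟨ through-c a₂ ⟩
      B u v w a₂ c * B w y z c b    ≈⟨ *-congʳ (basis-off (a₂c∉v ∘ proj₁ ∘ proj₂ ∘ cell-components)) ⟩
      0# * B w y z c b              ≈⟨ zeroˡ _ ⟩
      0#                            ∎

  no-obstruction⇒subalgebra : QuasiThin S x → ¬ Obstruction → UnitalSubalgebra S x
  no-obstruction⇒subalgebra qt no-obstruction =
      cellConstant⇒InT0 (λ _ → ≈-refl)
    , (λ M N M∈ N∈ → cellConstant⇒InT0 λ same → +-cong (InT0⇒cellConstant M∈ same) (InT0⇒cellConstant N∈ same))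
    , (λ s M M∈ → cellConstant⇒InT0 λ same → *-congˡ (InT0⇒cellConstant M∈ same))
    , (λ M N M∈ N∈ → cellConstant⇒InT0
                        (·-cellConstant qt no-obstruction (InT0⇒cellConstant M∈) (InT0⇒cellConstant N∈)))
    , cellConstant⇒InT0 I-cellConstant

lemma4p9 : ∀ {c ℓ : Level} (F : Field c ℓ) {n d : ℕ} (S : AssociationScheme n d) (x : Fin n) →
    QuasiThin S x →
    Matrices.UnitalSubalgebra F S x
      ⇔ (¬ (∃[ u ] ∃[ v ] ∃[ w ] ∃[ y ] ∃[ z ]
             ( valency S x u ≡ 2 × valency S x v ≡ 2 × valency S x w ≡ 2
             × valency S x y ≡ 2 × valency S x z ≡ 2
             × AssociationScheme.p S u v w ≡ 1
             × AssociationScheme.p S w y z ≡ 1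
             × prodSize S (AssociationScheme._′ S u) z ≡ 1)))
lemma4p9 F S x qt = mk⇔ (T₀.subalgebra⇒no-obstruction F S x) (T₀.no-obstruction⇒subalgebra F S x qt)
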